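{- Let $\mathcal{M} = (S, Z, N, U, \rho)$ be a marked static topology model such that (i) for every zone $z \in Z$ there exists $\mathbf{t} \in S \setminus U$ with $z \in \rho(\mathbf{t})$, and (ii) every sensor $\mathbf{s} \in S$ either lies in $U$ or is not possibly redundant in $\mathcal{M}$. Let $\mathcal{M}' = (S, Z, S \setminus U, U, \rho)$. Then $\mathcal{M}'$ is irreducible, i.e.: every zone $z \in Z$ lies in $\rho(\mathbf{y})$ for some $\mathbf{y} \in S \setminus U$; every sensor lies in $S \setminus U$ or in $U$; and every sensor that is possibly redundant in $\mathcal{M}'$ lies in $U$.
   Context: A marked static topology model is a tuple $(S, Z, N, U, \rho)$ where $S$ is a finite set of sensors, $Z \subseteq \mathcal{P}(S)$ with $\emptyset \notin Z$, every sensor lies in at least one zone, $\rho(\mathbf{s}) = \{z \in Z \mid \mathbf{s} \in z\}$, and $N, U \subseteq S$ are disjoint sets (sensors marked necessary and unnecessary). A sensor $\mathbf{s}$ is possibly redundant in $(S,Z,N,U,\rho)$ if for every $z \in \rho(\mathbf{s})$ there is $\mathbf{t} \in S$ with $\mathbf{t} \neq \mathbf{s}$, $\mathbf{t} \notin U$ and $z \in \rho(\mathbf{t})$. A non-empty marked model $(S,Z,N,U,\rho)$ is irreducible if every zone lies in the range of some sensor in $N$, every sensor lies in $N \cup U$, and every possibly redundant sensor lies in $U$. -}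

module Defs where

open import Data.Nat using (ℕ)
open import Data.Fin using (Fin)
open import Data.Fin.Subset using (Subset; _∈_; _∉_; ∁; Empty; Nonempty)
open import Data.List using (List)
open import Data.List.Membership.Propositional using () renaming (_∈_ to _∈ₗ_)
open import Data.List.Relation.Unary.Unique.Propositional using (Unique)
open import Data.List.Relation.Unary.All using (All)
open import Data.Product using (Σ; ∃; _×_; _,_)
open import Relation.Binary.PropositionalEquality using (_≡_)
open import Relation.Nullary using (¬_)
open import Data.Sum using (_⊎_)

-- Sensors: S = Fin n.  Zones: a duplicate-free list of subsets of S
-- (so Z is a finite subset of P(S)).  ρ(s) = {z ∈ Z | s ∈ z}, hence
-- "z ∈ ρ(s)" is "z ∈ Z and s ∈ z".
record Model (n : ℕ) : Set where
  field
    Z       : List (Subset n)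
    Z-set   : Unique Z
    Z-ne    : All Nonempty Z
    cover   : (s : Fin n) → Σ (Subset n) λ z → z ∈ₗ Z × s ∈ z
    N       : Subset n
    U       : Subset n
    disj    : (s : Fin n) → s ∈ N → s ∉ U
open Model public

_∈ρ[_]_ : ∀ {n} → Subset n → Model n → Fin n → Set
z ∈ρ[ M ] s = z ∈ₗ Z M × s ∈ z

PossiblyRedundant : ∀ {n} → Model n → Fin n → Set
PossiblyRedundant M s =
  (z : Subset _) → z ∈ρ[ M ] s →
  Σ (Fin _) λ t → ¬ (t ≡ s) × t ∉ U M × z ∈ρ[ M ] t

-- The three clauses of irreducibility (as spelled out in the lemma's "i.e.");
-- the non-emptiness proviso of the definition is not part of the claim.
Irreducible : ∀ {n} → Model n → Set
Irreducible {n} M =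
  ((z : Subset n) → z ∈ₗ Z M → Σ (Fin n) λ y → y ∈ N M × z ∈ρ[ M ] y) ×
  ((s : Fin n) → s ∈ N M ⊎ s ∈ U M) ×
  ((s : Fin n) → PossiblyRedundant M s → s ∈ U M)

complementModel : ∀ {n} → Model n → Model n
complementModel M = record
  { Z = Z M ; Z-set = Z-set M ; Z-ne = Z-ne M ; cover = cover M
  ; N = ∁ (U M) ; U = U M ; disj = λ s s∈∁U s∈U → disjointness s s∈∁U s∈U }
  where
    open import Data.Fin.Subset.Properties using (x∈∁p⇒x∉p)
    disjointness : ∀ s → s ∈ ∁ (U M) → s ∉ U M
    disjointness s = x∈∁p⇒x∉p

module Submission where

-- The model M' = (S, Z, S \ U, U, ρ) differs from M only in its set of
-- necessary sensors, and each clause of irreducibility for M' follows from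
-- one general observation:
--   * zone coverage: a witness t ∉ U covering z is, by definition, a
--     sensor of N' = S \ U covering z (hypothesis (i));
--   * marking: every sensor lies in S \ U or in U, since membership in a
--     finite subset is decidable;
--   * redundancy: whether a sensor is possibly redundant depends only on the
--     zones and the unnecessary sensors, not on N, so M and M' agree on it;
--     hypothesis (ii) then rules out every redundant sensor outside U.

open import Defs
open import Data.Nat using (ℕ)
open import Data.Fin using (Fin)
open import Data.Fin.Subset using (Subset; _∈_; _∉_; ∁)
open import Data.Fin.Subset.Properties using (x∉p⇒x∈∁p; _∈?_)
open import Data.List.Membership.Propositional using () renaming (_∈_ to _∈ₗ_)
open import Data.Product using (Σ; _×_; _,_)
open import Data.Sum using (_⊎_; inj₁; inj₂)
open import Data.Empty using (⊥-elim)
open import Relation.Nullary using (¬_; yes; no)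
open import Relation.Binary.PropositionalEquality using (_≡_; refl)

complement-or-member : ∀ {n} (p : Subset n) (s : Fin n) → s ∈ ∁ p ⊎ s ∈ p
complement-or-member p s with s ∈? p
... | yes s∈p = inj₂ s∈p
... | no  s∉p = inj₁ (x∉p⇒x∈∁p s∉p)

-- Possible redundancy only mentions the zones and the unnecessary sensors,
-- so it is preserved between models that share Z and U.
redundancy-transfer : ∀ {n} (M M′ : Model n) → Z M′ ≡ Z M → U M′ ≡ U M →
  ∀ s → PossiblyRedundant M′ s → PossiblyRedundant M s
redundancy-transfer M M′ refl refl s redundant = redundant

unnecessary-if-redundant : ∀ {n} (M : Model n) (s : Fin n) →
  s ∈ U M ⊎ ¬ PossiblyRedundant M s → PossiblyRedundant M s → s ∈ U M
unnecessary-if-redundant M s (inj₁ s∈U)        _         = s∈U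
unnecessary-if-redundant M s (inj₂ irredundant) redundant = ⊥-elim (irredundant redundant)

lemma6 : {n : ℕ} (M : Model n) →
    ((z : Subset n) → z ∈ₗ Z M → Σ (Fin n) λ t → t ∉ U M × z ∈ρ[ M ] t) →
    ((s : Fin n) → s ∈ U M ⊎ ¬ PossiblyRedundant M s) →
    Irreducible (complementModel M)
lemma6 M zones-covered not-redundant = zones-necessary , marked , redundant-unnecessary
  where
  M′ = complementModel M

  zones-necessary : (z : Subset _) → z ∈ₗ Z M′ → Σ (Fin _) λ y → y ∈ N M′ × z ∈ρ[ M′ ] y
  zones-necessary z z∈Z with zones-covered z z∈Z
  ... | t , t∉U , z∈ρt = t , x∉p⇒x∈∁p t∉U , z∈ρt

  marked : ∀ s → s ∈ N M′ ⊎ s ∈ U M′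
  marked = complement-or-member (U M)

  redundant-unnecessary : ∀ s → PossiblyRedundant M′ s → s ∈ U M′
  redundant-unnecessary s redundant =
    unnecessary-if-redundant M s (not-redundant s)
      (redundancy-transfer M M′ refl refl s redundant)
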